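{- Let $M,N$ be terms and $\mathtt n$ a multi-distribution. If $M\to_{\neg\mathsf w\beta_v}[N]$ and $N\to_\oplus\mathtt n$, then there is a multi-distribution $\mathtt m$ such that $M\to_\oplus\mathtt m$ and $\mathtt m\Rrightarrow_{\beta_v}\mathtt n$.
   Context: Terms: $M::=x\mid\lambda x.M\mid MM\mid M\oplus M$; values $V::=x\mid\lambda x.M$. Contexts $C::=\langle\cdot\rangle\mid CM\mid MC\mid\lambda x.C\mid C\oplus M\mid M\oplus C$; weak contexts $S::=\langle\cdot\rangle\mid SM\mid MS$. A multi-distribution is a finite multiset $[p_iM_i\mid i\in I]$ with $p_i\in(0,1]$, $\sum_i p_i\le1$; $[M]$ means $[1M]$, $+$ is multiset sum and $q\cdot[p_iM_i]_i=[(qp_i)M_i]_i$. Steps: $C\langle(\lambda x.M)V\rangle\to_{\beta_v}[C\langle M\{x:=V\}\rangle]$; $S\langle M\oplus N\rangle\to_\oplus[\tfrac12S\langle M\rangle,\tfrac12S\langle N\rangle]$ ($S$ weak). $\to_{\neg\mathsf w\beta_v}$ is the restriction of $\to_{\beta_v}$ to contexts $C$ that are not weak. The lifting $\Rrightarrow_{\beta_v}$ of $\to_{\beta_v}$ is inductively defined by: $[M]\Rrightarrow[M]$; $[M]\Rrightarrow\mathtt m$ if $M\to_{\beta_v}\mathtt m$; $[p_iM_i\mid i\in I]\Rrightarrow\sum_ip_i\cdot\mathtt m_i$ if $[M_i]\Rrightarrow\mathtt m_i$ for all $i$. -}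

module Defs where

open import Data.Nat using (ℕ; zero; suc; _<ᵇ_; _≡ᵇ_)
open import Data.Nat.Base using (pred)
open import Data.Bool using (if_then_else_)
open import Data.Rational using (ℚ; _*_; ½; 1ℚ)
open import Data.Product using (_×_; _,_)
open import Data.List using (List; []; _∷_; [_]; _++_; map)
open import Relation.Nullary using (¬_)

-- Terms (de Bruijn indices; α-equivalence is syntactic equality)

infixl 7 _·_
infixl 6 _⊕_

data Term : Set where
  var : ℕ → Term
  lam : Term → Term
  _·_ : Term → Term → Term
  _⊕_ : Term → Term → Term

data IsValue : Term → Set where
  var-val : ∀ n → IsValue (var n)
  lam-val : ∀ M → IsValue (lam M)

shift : ℕ → Term → Term
shift c (var n) = if n <ᵇ c then var n else var (suc n)
shift c (lam M) = lam (shift (suc c) M)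
shift c (M · N) = shift c M · shift c N
shift c (M ⊕ N) = shift c M ⊕ shift c N

-- capture-avoiding substitution of V for index j (removing binder j)
subst : ℕ → Term → Term → Term
subst j V (var n) =
  if n ≡ᵇ j then V else (if n <ᵇ j then var n else var (pred n))
subst j V (lam M) = lam (subst (suc j) (shift 0 V) M)
subst j V (M · N) = subst j V M · subst j V N
subst j V (M ⊕ N) = subst j V M ⊕ subst j V N

-- M{x:=V} where x is the variable bound by the λ
_[_≔] : Term → Term → Term
M [ V ≔] = subst 0 V M

data Ctx : Set where
  hole : Ctx
  _·ˡ_ : Ctx → Term → Ctx
  _·ʳ_ : Term → Ctx → Ctx
  lamC : Ctx → Ctx
  _⊕ˡ_ : Ctx → Term → Ctx
  _⊕ʳ_ : Term → Ctx → Ctx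

plug : Ctx → Term → Term
plug hole P = P
plug (C ·ˡ M) P = plug C P · M
plug (M ·ʳ C) P = M · plug C P
plug (lamC C) P = lam (plug C P)
plug (C ⊕ˡ M) P = plug C P ⊕ M
plug (M ⊕ʳ C) P = M ⊕ plug C P

data Weak : Ctx → Set where
  hole : Weak hole
  appL : ∀ {S} M → Weak S → Weak (S ·ˡ M)
  appR : ∀ {S} M → Weak S → Weak (M ·ʳ S)

-- Multi-distributions: finite multisets [p_i M_i] as lists
-- (multiset equality = list permutation _↭_)

MDist : Set
MDist = List (ℚ × Term)

δ : Term → MDist
δ M = [ (1ℚ , M) ]

scale : ℚ → MDist → MDist
scale q = map (λ { (p , M) → (q * p , M) })

data _→βv_ : Term → MDist → Set where
  βv : ∀ C M V → IsValue V → plug C (lam M · V) →βv δ (plug C (M [ V ≔]))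

data _→¬wβv_ : Term → MDist → Set where
  ¬wβv : ∀ C M V → ¬ Weak C → IsValue V →
         plug C (lam M · V) →¬wβv δ (plug C (M [ V ≔]))

data _→⊕_ : Term → MDist → Set where
  oplus : ∀ S M N → Weak S →
          plug S (M ⊕ N) →⊕ ((½ , plug S M) ∷ (½ , plug S N) ∷ [])

mutual
  data _⇛βv_ : MDist → MDist → Set where
    lift-refl : ∀ M → δ M ⇛βv δ M
    lift-step : ∀ {M m} → M →βv m → δ M ⇛βv m
    lift-sum  : ∀ {ms ns} → LiftAll ms ns → ms ⇛βv ns

  data LiftAll : MDist → MDist → Set where
    []  : LiftAll [] []
    _∷_ : ∀ {p M m ms ns} → δ M ⇛βv m → LiftAll ms ns →
          LiftAll ((p , M) ∷ ms) (scale p m ++ ns)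

module Submission where

-- Write the ¬wβv step as M = C⟨R⟩ → N = C⟨Q⟩ with R = (λP)V,
-- Q = P{V}, C a non-weak context, and the ⊕ step as N = S⟨A ⊕ B⟩ with S weak.
-- Because C is not weak, its hole lies under a λ or inside a ⊕, so it cannot
-- contain the weak position of the choice redex: either the hole sits inside
-- one branch of that very ⊕ (so its weak prefix is part of S), or it sits in
-- a sibling subterm of an application on the weak path.  In both cases the
-- same choice redex already occurs in M = S₀⟨A₀ ⊕ B₀⟩, and each branch
-- S₀⟨A₀⟩, S₀⟨B₀⟩ differs from S⟨A⟩, S⟨B⟩ by replacing at most one R by Q.

open import Defs
open import Data.Product using (Σ; _×_; _,_)
open import Data.List.Relation.Binary.Permutation.Propositional using (_↭_; ↭-refl)
open import Data.List using ([]; _∷_)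
open import Data.Empty using (⊥-elim)
open import Data.Rational using (½)
open import Relation.Nullary using (¬_)
open import Relation.Binary.PropositionalEquality using (_≡_; refl; sym; cong)
  renaming (subst to transport)

data Replace (R Q : Term) : Term → Term → Set where
  same : ∀ {X} → Replace R Q X X
  at   : ∀ D → Replace R Q (plug D R) (plug D Q)

replace-·ˡ : ∀ {R Q X Y} Z → Replace R Q X Y → Replace R Q (X · Z) (Y · Z)
replace-·ˡ Z same   = same
replace-·ˡ Z (at D) = at (D ·ˡ Z)

replace-·ʳ : ∀ {R Q X Y} Z → Replace R Q X Y → Replace R Q (Z · X) (Z · Y)
replace-·ʳ Z same   = same
replace-·ʳ Z (at D) = at (Z ·ʳ D)

βv-replace-lift : ∀ {P V X Y} → IsValue V →
  Replace (lam P · V) (P [ V ≔]) X Y → δ X ⇛βv δ Y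
βv-replace-lift isV same   = lift-refl _
βv-replace-lift isV (at D) = lift-step (βv D _ _ isV)

·-injective : ∀ {X Y X′ Y′} → X · Y ≡ X′ · Y′ → (X ≡ X′) × (Y ≡ Y′)
·-injective refl = refl , refl

record Residual (R Q T : Term) (S : Ctx) (A B : Term) : Set where
  constructor residual
  field
    ctx           : Ctx
    left right    : Term
    weak          : Weak ctx
    split         : T ≡ plug ctx (left ⊕ right)
    left-replace  : Replace R Q (plug ctx left) (plug S A)
    right-replace : Replace R Q (plug ctx right) (plug S B)

residual-·ˡ : ∀ {R Q T S A B} X → Residual R Q T S A B →
  Residual R Q (T · X) (S ·ˡ X) A B
residual-·ˡ X (residual S₀ A₀ B₀ w split rA rB) =
  residual (S₀ ·ˡ X) A₀ B₀ (appL X w) (cong (_· X) split)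
           (replace-·ˡ X rA) (replace-·ˡ X rB)

residual-·ʳ : ∀ {R Q T S A B} X → Residual R Q T S A B →
  Residual R Q (X · T) (X ·ʳ S) A B
residual-·ʳ X (residual S₀ A₀ B₀ w split rA rB) =
  residual (X ·ʳ S₀) A₀ B₀ (appR X w) (cong (X ·_) split)
           (replace-·ʳ X rA) (replace-·ʳ X rB)

weak-choice-residual : ∀ {R Q} C S {A B} → ¬ Weak C → Weak S →
  plug C Q ≡ plug S (A ⊕ B) → Residual R Q (plug C R) S A B
weak-choice-residual hole S nw w eq = ⊥-elim (nw hole)
-- the hole of C is inside a branch of the choice redex itself
weak-choice-residual {R} (C ⊕ˡ X) hole nw w refl =
  residual hole (plug C R) X hole refl (at C) same
weak-choice-residual {R} (X ⊕ʳ C) hole nw w refl =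
  residual hole X (plug C R) hole refl same (at C)
-- the hole of C and the weak path of S go into different sides of an application
weak-choice-residual {R} (C ·ˡ X) (Y ·ʳ S) {A} {B} nw (appR .Y w) refl =
  residual (plug C R ·ʳ S) A B (appR _ w) refl
           (at (C ·ˡ plug S A)) (at (C ·ˡ plug S B))
weak-choice-residual {R} (X ·ʳ C) (S ·ˡ Y) {A} {B} nw (appL .Y w) refl =
  residual (S ·ˡ plug C R) A B (appL _ w) refl
           (at (plug S A ·ʳ C)) (at (plug S B ·ʳ C))
weak-choice-residual (C ·ˡ X) (S ·ˡ Y) nw (appL .Y w) eq with ·-injective eq
... | eq′ , refl =
  residual-·ˡ X (weak-choice-residual C S (λ wC → nw (appL X wC)) w eq′)
weak-choice-residual (X ·ʳ C) (Y ·ʳ S) nw (appR .Y w) eq with ·-injective eq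
... | refl , eq′ =
  residual-·ʳ X (weak-choice-residual C S (λ wC → nw (appR X wC)) w eq′)
weak-choice-residual (lamC C) hole     nw w ()
weak-choice-residual (lamC C) (S ·ˡ X) nw w ()
weak-choice-residual (lamC C) (X ·ʳ S) nw w ()
weak-choice-residual (C ·ˡ X) hole     nw w ()
weak-choice-residual (X ·ʳ C) hole     nw w ()

oplus-at : ∀ {T} S A B → Weak S → T ≡ plug S (A ⊕ B) →
  T →⊕ ((½ , plug S A) ∷ (½ , plug S B) ∷ [])
oplus-at S A B w split = transport (_→⊕ _) (sym split) (oplus S A B w)

lemmaB1 : ∀ {M N n} → M →¬wβv δ N → N →⊕ n →
    Σ MDist (λ m → (M →⊕ m) × Σ MDist (λ n′ → (m ⇛βv n′) × (n′ ↭ n)))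
lemmaB1 (¬wβv C P V nw isV) = commute refl
  where
  -- N is kept abstract so that the ⊕ step can be inverted.
  commute : ∀ {N n} → N ≡ plug C (P [ V ≔]) → N →⊕ n →
    Σ MDist (λ m → (plug C (lam P · V) →⊕ m) × Σ MDist (λ n′ → (m ⇛βv n′) × (n′ ↭ n)))
  commute eq (oplus S A B w)
    with residual S₀ A₀ B₀ w₀ split rA rB ← weak-choice-residual C S nw w (sym eq) =
    _ , oplus-at S₀ A₀ B₀ w₀ split ,
    _ , lift-sum (βv-replace-lift isV rA ∷ (βv-replace-lift isV rB ∷ [])) , ↭-refl
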